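{- For any graph $G$, $\lfloor \mathrm{Z}\rfloor(G)\leq \mathrm{H}(G)\leq \mathrm{Z}(G)+1$.
   Context: All graphs are finite, simple and undirected; $N(v)$ is the open neighborhood of $v$. Vertices are colored blue or white; starting from an initial blue set $B$, forces are applied one at a time until no further force is possible, and $B$ is a forcing set (for a given rule) if some such sequence turns every vertex blue. Standard color change rule: a blue vertex $v$ may force a white vertex $w$ to become blue if $w$ is the unique white neighbor of $v$. $\mathrm{Z}(G)$ is the minimum size of a forcing set under the standard rule (the zero forcing number). Hopping color change rule: a blue vertex $v$ may force any white vertex $w$ (not necessarily adjacent) if $v$ has not previously performed a force and every vertex of $N(v)$ is blue. $\mathrm{H}(G)$ is the minimum size of a forcing set under the hopping rule. $\lfloor \mathrm{Z}\rfloor(G)=\min\{\mathrm{Z}(G') : G \text{ is a minor of } G'\}$ is the minor monotone floor of $\mathrm{Z}$; equivalently (a known result), $\lfloor\mathrm{Z}\rfloor(G)$ is the minimum size of a forcing set under the rule in which at each step one may apply either the standard rule or the hopping rule. -}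

module Defs where

open import Data.Nat using (ℕ; _≤_)
open import Data.Bool using (Bool; true; false)
open import Data.Fin using (Fin)
open import Data.Fin.Subset using (Subset; ∣_∣; _∈_; _∉_; inside)
open import Data.Vec using (_[_]≔_)
open import Data.Maybe using (Maybe; just)
open import Data.List using (List; _∷_; [])
open import Data.List.Membership.Propositional using () renaming (_∈_ to _∈ₗ_)
open import Data.Product using (Σ; _×_; ∃; ∃-syntax)
open import Relation.Nullary using (¬_)
open import Relation.Binary.PropositionalEquality using (_≡_)

record Graph : Set where
  field
    n      : ℕ
    adj    : Fin n → Fin n → Bool
    sym    : ∀ u v → adj u v ≡ adj v u
    irrefl : ∀ v → adj v v ≡ false
open Graph public

-- Color change rules.  The blue set is a Subset (Vec Bool n);
-- `used` lists the vertices that have already performed a force.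

Rule : Set₁
Rule = (G : Graph) → Subset (n G) → List (Fin (n G)) → Fin (n G) → Fin (n G) → Set

StandardForce : Rule
StandardForce G B used v w =
  (v ∈ B) × (w ∉ B) × (adj G v w ≡ true) ×
  (∀ u → adj G v u ≡ true → u ∉ B → u ≡ w)

HoppingForce : Rule
HoppingForce G B used v w =
  (v ∈ B) × (w ∉ B) × ¬ (v ∈ₗ used) ×
  (∀ u → adj G v u ≡ true → u ∈ B)

data Completes (R : Rule) (G : Graph) : Subset (n G) → List (Fin (n G)) → Set where
  done  : ∀ {B used} → (∀ x → x ∈ B) → Completes R G B used
  force : ∀ {B used} v w → R G B used v w →
          Completes R G (B [ w ]≔ inside) (v ∷ used) → Completes R G B used

ForcingSet : Rule → (G : Graph) → Subset (n G) → Set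
ForcingSet R G B = Completes R G B []

IsMinForcingNumber : Rule → Graph → ℕ → Set
IsMinForcingNumber R G k =
  (Σ (Subset (n G)) λ B → ForcingSet R G B × ∣ B ∣ ≡ k) ×
  (∀ B → ForcingSet R G B → k ≤ ∣ B ∣)

IsZ : Graph → ℕ → Set
IsZ = IsMinForcingNumber StandardForce

IsH : Graph → ℕ → Set
IsH = IsMinForcingNumber HoppingForce

-- Walk in G from x to y all of whose vertices lie in S (x assumed in S).
data WalkIn (G : Graph) (S : Fin (n G) → Set) : Fin (n G) → Fin (n G) → Set where
  here : ∀ {x} → WalkIn G S x x
  step : ∀ {x y z} → adj G x y ≡ true → S y → WalkIn G S y z → WalkIn G S x z

-- IsMinor H G : H is a minor of G.  φ x = just u means x is in the
-- branch set of u; φ x = nothing means x is deleted.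
record IsMinor (H G : Graph) : Set where
  field
    φ         : Fin (n G) → Maybe (Fin (n H))
    nonempty  : ∀ u → ∃[ x ] (φ x ≡ just u)
    connected : ∀ u x y → φ x ≡ just u → φ y ≡ just u →
                WalkIn G (λ z → φ z ≡ just u) x y
    edges     : ∀ u v → adj H u v ≡ true →
                ∃[ x ] ∃[ y ] (φ x ≡ just u × φ y ≡ just v × adj G x y ≡ true)

IsFloorZ : Graph → ℕ → Set
IsFloorZ G k =
  (Σ Graph λ G' → IsMinor G G' × IsZ G' k) ×
  (∀ G' k' → IsMinor G G' → IsZ G' k' → k ≤ k')

-- Given a hopping chronology from B, add to G an edge v w for every hop v → w; G is a
-- spanning subgraph, hence a minor, of the new graph G′.  The same chronology is standard in G′:
-- when v hops to w, all G-neighbours of v are blue, v makes no other hop, and any u that hopped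
-- to v did so earlier and is blue, so w is the only white G′-neighbour of v.  Hence Z(G′) ≤ |B|;
-- that Z(G′) exists at all follows from forcing sets being decidable by exhaustive search.
--
-- H ≤ Z + 1.  Let v₁ → w₁, v₂ → w₂, … be a standard chronology from B.  From B ∪ {w₁}, each vᵢ,
-- whose neighbours are all blue once wᵢ is, hops to wᵢ₊₁.  No vᵢ₊₁ has hopped before its turn:
-- every earlier hopper has only blue neighbours, while vᵢ₊₁ still has the white neighbour wᵢ₊₁.

module Submission where

open import Defs
open import Data.Bool using (true; false; _∨_)
import Data.Bool as Bool
open import Data.Bool.Properties using (∨-zeroʳ)
open import Data.Empty using (⊥-elim)
open import Data.Fin using (Fin; zero; suc; _≟_)
open import Data.Fin.Properties using (all?; any?)
open import Data.Fin.Subset using (Subset; ∣_∣; _∈_; _∉_; inside; outside)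
open import Data.Fin.Subset.Properties using (_∈?_; ∣p∣≤n; anySubset?)
open import Data.List using (List; []; _∷_)
open import Data.List.Relation.Unary.Any using (here; there)
open import Data.Maybe using (just)
open import Data.Nat using (ℕ; _≤_; _<_; _+_)
import Data.Nat as ℕ
open import Data.Nat.Induction using (<-rec)
open import Data.Nat.Properties
  using (≤-trans; ≤-reflexive; <-≤-trans; n≤1+n; ≮⇒≥; n≮n; m≤n+m; +-comm; +-suc; +-identityʳ; anyUpTo?)
open import Data.Product using (∃; _×_; _,_; proj₁; proj₂)
open import Data.Product.Properties using (≡-dec)
open import Data.Sum using (_⊎_; inj₁; inj₂; swap)
open import Data.Vec.Base using (_∷_; _[_]≔_)
import Data.Vec.Base as Vec
open import Data.Vec.Properties using ([]≔-updates; []≔-minimal)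
open import Function using (_∘_; mk⇔)
open import Relation.Nullary using (¬_; Dec; yes; no; does)
open import Relation.Nullary.Decidable using (map′; _×-dec_; _⊎-dec_; _→-dec_; ¬?; dec-true; dec-false; does-⇔)
open import Relation.Unary using (Pred; Decidable)
open import Relation.Binary.PropositionalEquality using (_≡_; _≢_; refl; cong; cong₂; subst)
import Relation.Binary.PropositionalEquality as ≡

open import Data.List.Membership.Propositional using () renaming (_∈_ to _∈ₗ_)

x∈p⇒x∈p[y]≔inside : ∀ {k} {x y : Fin k} {p : Subset k} → x ∈ p → x ∈ p [ y ]≔ inside
x∈p⇒x∈p[y]≔inside {x = x} {y} {p} x∈p with x ≟ y
... | yes refl = []≔-updates p x
... | no x≢y   = []≔-minimal p x y x≢y x∈p

x∉p⇒∣p[x]≔inside∣≡1+∣p∣ : ∀ {k} (x : Fin k) (p : Subset k) → x ∉ p → ∣ p [ x ]≔ inside ∣ ≡ ℕ.suc ∣ p ∣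
x∉p⇒∣p[x]≔inside∣≡1+∣p∣ zero    (inside  ∷ p) x∉p = ⊥-elim (x∉p Vec.here)
x∉p⇒∣p[x]≔inside∣≡1+∣p∣ zero    (outside ∷ p) x∉p = refl
x∉p⇒∣p[x]≔inside∣≡1+∣p∣ (suc x) (inside  ∷ p) x∉p =
  cong ℕ.suc (x∉p⇒∣p[x]≔inside∣≡1+∣p∣ x p (x∉p ∘ Vec.there))
x∉p⇒∣p[x]≔inside∣≡1+∣p∣ (suc x) (outside ∷ p) x∉p =
  x∉p⇒∣p[x]≔inside∣≡1+∣p∣ x p (x∉p ∘ Vec.there)

x∉p⇒∣p∣<n : ∀ {k} {x : Fin k} (p : Subset k) → x ∉ p → ∣ p ∣ < k
x∉p⇒∣p∣<n {x = x} p x∉p =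
  ≤-trans (≤-reflexive (≡.sym (x∉p⇒∣p[x]≔inside∣≡1+∣p∣ x p x∉p))) (∣p∣≤n (p [ x ]≔ inside))

∨-does⇒ : ∀ {a} {A : Set a} {b} (a? : Dec A) → b ∨ does a? ≡ true → b ≡ true ⊎ A
∨-does⇒ {b = true}  _       _  = inj₁ refl
∨-does⇒ {b = false} (yes a) _  = inj₂ a
∨-does⇒ {b = false} (no _)  ()

Least : ∀ {p} → Pred ℕ p → Pred ℕ p
Least P k = P k × (∀ {j} → P j → k ≤ j)

least-witness : ∀ {p} {P : Pred ℕ p} → Decidable P → ∀ {m} → P m → ∃ (Least P)
least-witness {P = P} P? {m} = <-rec (λ m → P m → ∃ (Least P)) search m
  where
  search : ∀ m → (∀ {i} → i < m → P i → ∃ (Least P)) → P m → ∃ (Least P)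
  search m smaller Pm with anyUpTo? P? m
  ... | yes (i , i<m , Pi) = smaller i<m Pi
  ... | no ¬P<m            = m , Pm , λ Pj → ≮⇒≥ λ j<m → ¬P<m (_ , j<m , Pj)

module _ {R : Rule} {G : Graph}
         (R? : ∀ B us v w → Dec (R G B us v w))
         (R⇒white : ∀ {B us v w} → R G B us v w → w ∉ B) where

  private
    completes?′ : ∀ k B us → n G ≤ ∣ B ∣ + k → Dec (Completes R G B us)
    forcesAndCompletes? : ∀ k B us → n G ≤ ∣ B ∣ + k → ∀ v w →
                          Dec (R G B us v w × Completes R G (B [ w ]≔ inside) (v ∷ us))

    completes?′ k B us room with all? (_∈? B)
    ... | yes allBlue = yes (done allBlue)
    ... | no ¬allBlue =
      map′ (λ (v , w , r , c) → force v w r c) firstForce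
           (any? λ v → any? λ w → forcesAndCompletes? k B us room v w)
      where
      firstForce : Completes R G B us →
                   ∃ λ v → ∃ λ w → R G B us v w × Completes R G (B [ w ]≔ inside) (v ∷ us)
      firstForce (done allBlue)  = ⊥-elim (¬allBlue allBlue)
      firstForce (force v w r c) = v , w , r , c

    forcesAndCompletes? k B us room v w with R? B us v w
    ... | no ¬r = no (¬r ∘ proj₁)
    forcesAndCompletes? ℕ.zero B us room v w | yes r =
      ⊥-elim (n≮n _ (<-≤-trans (x∉p⇒∣p∣<n B (R⇒white r)) (≤-trans room (≤-reflexive (+-identityʳ _)))))
    forcesAndCompletes? (ℕ.suc k) B us room v w | yes r =
      map′ (r ,_) proj₂ (completes?′ k (B [ w ]≔ inside) (v ∷ us) (≤-trans room (≤-reflexive room′)))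
      where
      room′ : ∣ B ∣ + ℕ.suc k ≡ ∣ B [ w ]≔ inside ∣ + k
      room′ = ≡.trans (+-suc ∣ B ∣ k)
                      (cong (_+ k) (≡.sym (x∉p⇒∣p[x]≔inside∣≡1+∣p∣ w B (R⇒white r))))

  completes? : ∀ B us → Dec (Completes R G B us)
  completes? B us = completes?′ (n G) B us (m≤n+m (n G) ∣ B ∣)

minForcingNumber-exists : ∀ {R G} → (∀ B → Dec (ForcingSet R G B)) →
                          ∀ {B} → ForcingSet R G B → ∃ λ k → IsMinForcingNumber R G k × k ≤ ∣ B ∣
minForcingNumber-exists forcingSet? {B} fsB
  with least-witness (λ k → anySubset? λ C → forcingSet? C ×-dec ∣ C ∣ ℕ.≟ k) (B , fsB , refl)
... | k , witness , least = k , (witness , λ C fsC → least (C , fsC , refl)) , least (B , fsB , refl)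

standardForce? : ∀ G B us v w → Dec (StandardForce G B us v w)
standardForce? G B us v w =
  v ∈? B ×-dec ¬? (w ∈? B) ×-dec adj G v w Bool.≟ true ×-dec
  all? (λ u → adj G v u Bool.≟ true →-dec ¬? (u ∈? B) →-dec u ≟ w)

Z-exists : ∀ G {B} → ForcingSet StandardForce G B → ∃ λ k → IsZ G k × k ≤ ∣ B ∣
Z-exists G = minForcingNumber-exists (λ B → completes? (standardForce? G) (proj₁ ∘ proj₂) B [])

NeighboursIn : (G : Graph) → Fin (n G) → Subset (n G) → Set
NeighboursIn G v B = ∀ u → adj G v u ≡ true → u ∈ B

module _ (G : Graph) where

  standardForce⇒NeighboursIn : ∀ {B us v w} → StandardForce G B us v w →
                               NeighboursIn G v (B [ w ]≔ inside)
  standardForce⇒NeighboursIn {B} {w = w} (_ , _ , _ , onlyWhite) u vu with u ∈? B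
  ... | yes u∈B = x∈p⇒x∈p[y]≔inside u∈B
  ... | no u∉B  = subst (_∈ B [ w ]≔ inside) (≡.sym (onlyWhite u vu u∉B)) ([]≔-updates B w)

  standard⇒hopping-with-spare : ∀ {B us used} → Completes StandardForce G B us →
    ∀ {s} → s ∈ B → NeighboursIn G s B → ¬ s ∈ₗ used →
    (∀ {u} → u ∈ₗ used → NeighboursIn G u B) → Completes HoppingForce G B used
  standard⇒hopping-with-spare (done allBlue) _ _ _ _ = done allBlue
  standard⇒hopping-with-spare {B} {us} {used} (force v w std@(v∈B , w∉B , vw , _) d) {s}
                              s∈B sN s∉used usedN =
    force s w (s∈B , w∉B , s∉used , sN)
      (standard⇒hopping-with-spare d (x∈p⇒x∈p[y]≔inside v∈B) (standardForce⇒NeighboursIn {us = us} std)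
                                   v∉used usedN′)
    where
    v∉used : ¬ v ∈ₗ (s ∷ used)
    v∉used (here refl) = w∉B (sN w vw)
    v∉used (there v∈used) = w∉B (usedN v∈used w vw)
    usedN′ : ∀ {u} → u ∈ₗ (s ∷ used) → NeighboursIn G u (B [ w ]≔ inside)
    usedN′ (here refl)    x ux = x∈p⇒x∈p[y]≔inside (sN x ux)
    usedN′ (there u∈used) x ux = x∈p⇒x∈p[y]≔inside (usedN u∈used x ux)

  standard⇒hopping : ∀ {B} → ForcingSet StandardForce G B →
                     ∃ λ B′ → ForcingSet HoppingForce G B′ × ∣ B′ ∣ ≤ ℕ.suc ∣ B ∣
  standard⇒hopping {B} (done allBlue) = B , done allBlue , n≤1+n _
  standard⇒hopping {B} (force v w std@(v∈B , w∉B , _) d) =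
    B [ w ]≔ inside ,
    standard⇒hopping-with-spare d (x∈p⇒x∈p[y]≔inside v∈B) (standardForce⇒NeighboursIn {us = []} std)
                                (λ ()) (λ ()) ,
    ≤-reflexive (x∉p⇒∣p[x]≔inside∣≡1+∣p∣ w B w∉B)

forces : ∀ {R G B us} → Completes R G B us → List (Fin (n G) × Fin (n G))
forces (done _)        = []
forces (force v w _ d) = (v , w) ∷ forces d

pendingForce-fresh : ∀ {G B us} (d : Completes HoppingForce G B us) {a b} →
                     (a , b) ∈ₗ forces d → b ∉ B × ¬ a ∈ₗ us
pendingForce-fresh (force _ _ (_ , w∉B , v∉us , _) _) (here refl) = w∉B , v∉us
pendingForce-fresh (force _ _ _ d) (there later) =
  let b∉B′ , a∉us′ = pendingForce-fresh d later
  in b∉B′ ∘ x∈p⇒x∈p[y]≔inside , a∉us′ ∘ there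

module _ (G : Graph) (L : List (Fin (n G) × Fin (n G))) where

  open import Data.List.Membership.DecPropositional (≡-dec (_≟_ {n G}) (_≟_ {n G}))
    using () renaming (_∈?_ to _∈ₗ?_)

  Joined : Fin (n G) → Fin (n G) → Set
  Joined u v = u ≢ v × ((u , v) ∈ₗ L ⊎ (v , u) ∈ₗ L)

  joined? : ∀ u v → Dec (Joined u v)
  joined? u v = ¬? (u ≟ v) ×-dec ((u , v) ∈ₗ? L ⊎-dec (v , u) ∈ₗ? L)

  Joined-sym : ∀ {u v} → Joined u v → Joined v u
  Joined-sym (u≢v , uv∈L) = u≢v ∘ ≡.sym , swap uv∈L

  addEdges : Graph
  addEdges = record
    { n      = n G
    ; adj    = λ u v → adj G u v ∨ does (joined? u v)
    ; sym    = λ u v → cong₂ _∨_ (sym G u v)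
                                 (does-⇔ (mk⇔ Joined-sym Joined-sym) (joined? u v) (joined? v u))
    ; irrefl = λ v → cong₂ _∨_ (irrefl G v) (dec-false (joined? v v) λ (v≢v , _) → v≢v refl)
    }

  addEdges-minor : IsMinor G addEdges
  addEdges-minor = record
    { φ         = just
    ; nonempty  = λ u → u , refl
    ; connected = λ { _ _ _ refl refl → WalkIn.here }
    ; edges     = λ u v uv → u , v , refl , refl , cong (_∨ _) uv
    }

  addEdges-adj⁻ : ∀ {u v} → adj addEdges u v ≡ true → adj G u v ≡ true ⊎ Joined u v
  addEdges-adj⁻ {u} {v} = ∨-does⇒ (joined? u v)

  addEdges-joined : ∀ {u v} → Joined u v → adj addEdges u v ≡ true
  addEdges-joined {u} {v} joined = ≡.trans (cong (adj G u v ∨_) (dec-true (joined? u v) joined)) (∨-zeroʳ _)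

  hopping⇒standard : ∀ {B us} (d : Completes HoppingForce G B us) →
    (∀ {e} → e ∈ₗ forces d → e ∈ₗ L) →
    (∀ {a b} → (a , b) ∈ₗ L → (a , b) ∈ₗ forces d ⊎ (a ∈ B × b ∈ B)) →
    Completes StandardForce addEdges B us
  hopping⇒standard (done allBlue) _ _ = done allBlue
  hopping⇒standard {B} (force v w (v∈B , w∉B , _ , vN) d) forces⊆L L-settled =
    force v w (v∈B , w∉B , addEdges-joined (v≢w , inj₁ (forces⊆L (here refl))) , onlyWhite)
      (hopping⇒standard d (forces⊆L ∘ there) L-settled′)
    where
    v≢w : v ≢ w
    v≢w refl = w∉B v∈B
    onlyWhite : ∀ u → adj addEdges v u ≡ true → u ∉ B → u ≡ w
    onlyWhite u vu u∉B with addEdges-adj⁻ vu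
    ... | inj₁ vu∈G = ⊥-elim (u∉B (vN u vu∈G))
    ... | inj₂ (_ , inj₁ vu∈L) with L-settled vu∈L
    ...   | inj₁ (here refl)   = refl
    ...   | inj₁ (there later) = ⊥-elim (proj₂ (pendingForce-fresh d later) (here refl))
    ...   | inj₂ (_ , u∈B)     = ⊥-elim (u∉B u∈B)
    onlyWhite u vu u∉B | inj₂ (_ , inj₂ uv∈L) with L-settled uv∈L
    ...   | inj₁ (here uv≡vw)  = ⊥-elim (v≢w (cong proj₂ uv≡vw))
    ...   | inj₁ (there later) = ⊥-elim (proj₁ (pendingForce-fresh d later) (x∈p⇒x∈p[y]≔inside v∈B))
    ...   | inj₂ (u∈B , _)     = ⊥-elim (u∉B u∈B)
    L-settled′ : ∀ {a b} → (a , b) ∈ₗ L →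
                 (a , b) ∈ₗ forces d ⊎ (a ∈ B [ w ]≔ inside × b ∈ B [ w ]≔ inside)
    L-settled′ ab∈L with L-settled ab∈L
    ... | inj₁ (here refl)   = inj₂ (x∈p⇒x∈p[y]≔inside v∈B , []≔-updates B w)
    ... | inj₁ (there later) = inj₁ later
    ... | inj₂ (a∈B , b∈B)   = inj₂ (x∈p⇒x∈p[y]≔inside a∈B , x∈p⇒x∈p[y]≔inside b∈B)

⌊Z⌋≤H : ∀ G {f h} → IsFloorZ G f → IsH G h → f ≤ h
⌊Z⌋≤H G (_ , ⌊Z⌋-least) ((B , d , refl) , _) =
  let k , isZ , k≤∣B∣ = Z-exists (addEdges G (forces d)) (hopping⇒standard G (forces d) d (λ e → e) inj₁)
  in ≤-trans (⌊Z⌋-least _ k (addEdges-minor G (forces d)) isZ) k≤∣B∣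

H≤Z+1 : ∀ G {h z} → IsH G h → IsZ G z → h ≤ z + 1
H≤Z+1 G (_ , H-least) ((B , fs , refl) , _) =
  let B′ , fs′ , ∣B′∣≤1+∣B∣ = standard⇒hopping G fs
  in ≤-trans (H-least B′ fs′) (≤-trans ∣B′∣≤1+∣B∣ (≤-reflexive (+-comm 1 ∣ B ∣)))

proposition2p7 : (G : Graph) (f h z : ℕ) →
    IsFloorZ G f → IsH G h → IsZ G z →
    (f ≤ h) × (h ≤ z + 1)
proposition2p7 G f h z isFloorZ isH isZ = ⌊Z⌋≤H G isFloorZ isH , H≤Z+1 G isH isZ
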